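{- For every prime power $q$ and positive integers $k,d'$ we have $n_q(k,2d',1)\le 2\,n_q(k,d')$, $n_q(k,d'+2q^{k-1},1)\le 2\,\frac{q^k-1}{q-1}+n_q(k,d')$, and $n_q(k,3d'-1,1)\le 3\,n_q(k,d')-1$.
   Context: An $[n,k,d]_q$-code is a $k$-dimensional subspace of $\mathbb{F}_q^n$ with minimum Hamming distance at least $d$. $n_q(k,d)$ denotes the minimum length $n$ of an $[n,k,d]_q$-code. A linear code $C\subseteq\mathbb{F}_q^n$ has locality $r$ if for every coordinate $i$ there is a set $S_i\subseteq\{1,\dots,n\}\setminus\{i\}$ with $|S_i|\le r$ such that any two codewords agreeing on all coordinates in $S_i$ also agree in coordinate $i$. $n_q(k,d,r)$ denotes the minimum length $n$ of an $[n,k,d]_q$-code with locality $r$. -}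

module Defs where

open import Level using (0ℓ)
open import Data.Nat as ℕ using (ℕ; zero; suc; _≤_; _^_)
open import Data.Nat.Primality using (Prime)
open import Data.Fin using (Fin) renaming (zero to fzero; suc to fsuc)
open import Data.Fin.Subset using (Subset; _∈_; _∉_; ∣_∣)
open import Data.Product using (Σ; ∃; ∃₂; _×_)
open import Function.Bundles using (Bijection)
open import Relation.Binary.PropositionalEquality using (_≡_; _≢_; setoid)
open import Algebra.Structures using (IsCommutativeRing)

IsPrimePower : ℕ → Set
IsPrimePower q = ∃₂ λ p e → Prime p × 1 ≤ e × q ≡ p ^ e

record FiniteField (q : ℕ) : Set₁ where
  field
    Carrier : Set
    _+_ _*_ : Carrier → Carrier → Carrier
    -_ : Carrier → Carrier
    0# 1# : Carrier
    isCommutativeRing : IsCommutativeRing _≡_ _+_ _*_ -_ 0# 1#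
    0≢1 : 0# ≢ 1#
    inverse : ∀ x → x ≢ 0# → Σ Carrier λ y → x * y ≡ 1#
    enumeration : Bijection (setoid (Fin q)) (setoid Carrier)

module Codes {q : ℕ} (F : FiniteField q) where
  open FiniteField F

  Word : ℕ → Set
  Word n = Fin n → Carrier

  sumF : ∀ {k} → (Fin k → Carrier) → Carrier
  sumF {zero} v = 0#
  sumF {suc k} v = v fzero + sumF (λ i → v (fsuc i))

  encode : ∀ {k n} → (Fin k → Fin n → Carrier) → Word k → Word n
  encode {k} G m j = sumF (λ i → m i * G i j)

  InCode : ∀ {k n} → (Fin k → Fin n → Carrier) → Word n → Set
  InCode G c = Σ (Word _) λ m → ∀ j → c j ≡ encode G m j

  RowsIndependent : ∀ {k n} → (Fin k → Fin n → Carrier) → Set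
  RowsIndependent G = ∀ m → (∀ j → encode G m j ≡ 0#) → ∀ i → m i ≡ 0#

  DistAtLeast : ∀ {n} → ℕ → Word n → Word n → Set
  DistAtLeast {n} d c c' = Σ (Subset n) λ S → d ≤ ∣ S ∣ × (∀ j → j ∈ S → c j ≢ c' j)

  record LinCode (n k d : ℕ) : Set where
    field
      G : Fin k → Fin n → Carrier
      independent : RowsIndependent G
      minDist : ∀ c c' → InCode G c → InCode G c' →
                (Σ (Fin n) λ j → c j ≢ c' j) → DistAtLeast d c c'

  HasLocality : ∀ {n k d} → LinCode n k d → ℕ → Set
  HasLocality {n} C r = ∀ (i : Fin n) → Σ (Subset n) λ S → i ∉ S × ∣ S ∣ ≤ r ×
      (∀ c c' → InCode G c → InCode G c' → (∀ j → j ∈ S → c j ≡ c' j) → c i ≡ c' i)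
    where open LinCode C

  HasCode : ℕ → ℕ → ℕ → Set
  HasCode n k d = LinCode n k d

  HasLocalCode : ℕ → ℕ → ℕ → ℕ → Set
  HasLocalCode n k d r = Σ (LinCode n k d) λ C → HasLocality C r

-- (q^k - 1)/(q - 1) = Σ_{i<k} q^i
qNumber : ℕ → ℕ → ℕ
qNumber q zero = 0
qNumber q (suc k) = q ^ k ℕ.+ qNumber q k

{-# OPTIONS --safe #-}
-- Each code is obtained by juxtaposing generator matrices: [G | G], [S | G | S] where S generates
-- the q-ary simplex code (one column per point of the projective space PG(k − 1, q)), and
-- [G | G | G′] where G′ is G without its first column. Weights add up over blocks, and a nonzero
-- message has weight at least d′ on G, at least q^(k−1) on S and at least d′ − 1 on G′. In each
-- matrix every column is a scalar multiple of a column in another position, so every coordinate of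
-- a codeword is determined by a single other coordinate: the code has locality 1.
module Submission where

open import Defs
open import Level using (0ℓ)
open import Algebra.Bundles using (CommutativeRing)
import Algebra.Properties.CommutativeSemigroup as CommutativeSemigroupProperties
import Algebra.Properties.Group as GroupProperties
import Algebra.Properties.Semiring.Sum as SemiringSum
open import Data.Empty using (⊥-elim)
open import Data.Fin as Fin using (Fin; zero; suc; _↑ˡ_; _↑ʳ_; splitAt; combine; remQuot)
import Data.Fin.Properties as Finₚ
open import Data.Fin.Subset using (Subset; _∈_; ∣_∣; ⁅_⁆; inside; outside)
open import Data.Fin.Subset.Properties using (p⊆q⇒∣p∣≤∣q∣; x∈⁅x⁆; x≢y⇒x∉⁅y⁆; ∣⁅x⁆∣≡1)
open import Data.Nat as ℕ using (ℕ; zero; suc; _≤_; z≤n; s≤s)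
import Data.Nat.Properties as ℕₚ
open import Data.Nat.Tactic.RingSolver using (solve-∀)
open import Data.Product as Product using (Σ; ∃; _×_; _,_; uncurry)
open import Data.Sum using (_⊎_; inj₁; inj₂; [_,_])
open import Data.Vec.Base as Vec using ([]; here; there)
open import Data.Vec.Functional using (Vector; _++_; _∷_; tail; map)
open import Data.Vec.Functional.Properties using (lookup-++ˡ; lookup-++ʳ)
open import Function using (_∘_; _$_; flip; const)
open import Function.Bundles using (Bijection)
open import Function.Properties.Bijection using (sym-≡; Bijection⇒Inverse)
open import Function.Properties.Inverse using (Inverse⇒Injection)
open import Relation.Binary.Definitions using (DecidableEquality)
open import Relation.Binary.PropositionalEquality hiding ([_])
open import Relation.Nullary using (¬_; yes; no)
open import Relation.Nullary.Decidable using (via-injection)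

open SemiringSum ℕₚ.+-*-semiring using (sum; sum-syntax; sum-cong-≗; ∑-distrib-+; *-distribˡ-sum)

sum-const : ∀ n c → sum {n} (const c) ≡ n ℕ.* c
sum-const zero    c = refl
sum-const (suc n) c = cong (c ℕ.+_) (sum-const n c)

sum-mono-≤ : ∀ {n} {f g : Vector ℕ n} → (∀ i → f i ≤ g i) → sum f ≤ sum g
sum-mono-≤ {zero}  f≤g = z≤n
sum-mono-≤ {suc n} f≤g = ℕₚ.+-mono-≤ (f≤g zero) (sum-mono-≤ (f≤g ∘ suc))

sum-↑ : ∀ m {n} (f : Vector ℕ (m ℕ.+ n)) → sum f ≡ sum (f ∘ (_↑ˡ n)) ℕ.+ sum (f ∘ (m ↑ʳ_))
sum-↑ zero    f = refl
sum-↑ (suc m) f = trans (cong (f zero ℕ.+_) (sum-↑ m (tail f))) (sym (ℕₚ.+-assoc (f zero) _ _))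

sum-combine : ∀ m n (f : Vector ℕ (m ℕ.* n)) → sum f ≡ ∑[ i < m ] ∑[ j < n ] f (combine i j)
sum-combine zero    n f = refl
sum-combine (suc m) n f =
  trans (sum-↑ n f) (cong (sum (f ∘ (_↑ˡ m ℕ.* n)) ℕ.+_) (sum-combine m n (f ∘ (n ↑ʳ_))))

3*n∸1≡n+[n+[n∸1]] : ∀ n → 3 ℕ.* n ℕ.∸ 1 ≡ n ℕ.+ (n ℕ.+ (n ℕ.∸ 1))
3*n∸1≡n+[n+[n∸1]] zero    = refl
3*n∸1≡n+[n+[n∸1]] (suc n) = identity n
  where
  identity : ∀ n → n ℕ.+ (suc n ℕ.+ (suc n ℕ.+ 0)) ≡ suc n ℕ.+ (suc n ℕ.+ n)
  identity = solve-∀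

↑-elim : ∀ {m n} (P : Fin (m ℕ.+ n) → Set) → (∀ i → P (i ↑ˡ n)) → (∀ j → P (m ↑ʳ j)) → ∀ x → P x
↑-elim {m} {n} P left right x =
  subst P (Finₚ.join-splitAt m n x) ([_,_] {C = P ∘ Fin.join m n} left right (splitAt m x))

↑ˡ≢↑ʳ : ∀ {m n} (i : Fin m) (j : Fin n) → i ↑ˡ n ≢ m ↑ʳ j
↑ˡ≢↑ʳ {m} {n} i j eq
  with trans (sym (Finₚ.splitAt-↑ˡ m i n)) (trans (cong (splitAt m) eq) (Finₚ.splitAt-↑ʳ m n j))
... | ()

module _ {q : ℕ} (F : FiniteField q) where
  open FiniteField F
  open Codes F
  open Bijection enumeration using (to; injective; strictlySurjective)

  commutativeRing : CommutativeRing 0ℓ 0ℓ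
  commutativeRing = record { isCommutativeRing = isCommutativeRing }

  open CommutativeRing commutativeRing
    using ( +-group; semiring; *-commutativeSemigroup; +-assoc; +-identityˡ; +-identityʳ
          ; *-assoc; *-comm; *-identityˡ; *-identityʳ; zeroˡ; zeroʳ; distribʳ)
  open GroupProperties +-group using (∙-cancelˡ; \\-leftDividesˡ)
  open CommutativeSemigroupProperties *-commutativeSemigroup using (x∙yz≈y∙xz)
  module Σᶠ = SemiringSum semiring

  _≟_ : DecidableEquality Carrier
  _≟_ = via-injection (Inverse⇒Injection (Bijection⇒Inverse (sym-≡ enumeration))) Finₚ._≟_

  *-cancelˡ-≢0 : ∀ {d x y} → d ≢ 0# → d * x ≡ d * y → x ≡ y
  *-cancelˡ-≢0 {d} {x} {y} d≢0 dx≡dy with inverse d d≢0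
  ... | e , de≡1 = begin
    x             ≡⟨ *-identityˡ x ⟨
    1# * x        ≡⟨ cong (_* x) ed≡1 ⟨
    (e * d) * x   ≡⟨ *-assoc e d x ⟩
    e * (d * x)   ≡⟨ cong (e *_) dx≡dy ⟩
    e * (d * y)   ≡⟨ *-assoc e d y ⟨
    (e * d) * y   ≡⟨ cong (_* y) ed≡1 ⟩
    1# * y        ≡⟨ *-identityˡ y ⟩
    y             ∎
    where
    open ≡-Reasoning
    ed≡1 : e * d ≡ 1#
    ed≡1 = trans (*-comm e d) de≡1

  infix 30 _·_
  _·_ : ∀ {k} → Word k → Word k → Carrier
  u · v = sumF (λ i → u i * v i)

  sumF≡sum : ∀ {k} (v : Word k) → sumF v ≡ Σᶠ.sum v
  sumF≡sum {zero}  v = refl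
  sumF≡sum {suc k} v = cong (v zero +_) (sumF≡sum (tail v))

  ·-cong : ∀ {k} {u u′ v v′ : Word k} → (∀ i → u i ≡ u′ i) → (∀ i → v i ≡ v′ i) → u · v ≡ u′ · v′
  ·-cong {u = u} {u′} {v} {v′} u≗u′ v≗v′ = begin
    u · v                        ≡⟨ sumF≡sum (λ i → u i * v i) ⟩
    Σᶠ.sum (λ i → u i * v i)     ≡⟨ Σᶠ.sum-cong-≗ (λ i → cong₂ _*_ (u≗u′ i) (v≗v′ i)) ⟩
    Σᶠ.sum (λ i → u′ i * v′ i)   ≡⟨ sumF≡sum (λ i → u′ i * v′ i) ⟨
    u′ · v′                      ∎
    where open ≡-Reasoning

  ·-distribʳ-+ : ∀ {k} (u v w : Word k) → (λ i → u i + v i) · w ≡ u · w + v · w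
  ·-distribʳ-+ u v w = begin
    (λ i → u i + v i) · w                                ≡⟨ sumF≡sum (λ i → (u i + v i) * w i) ⟩
    Σᶠ.sum (λ i → (u i + v i) * w i)                     ≡⟨ Σᶠ.sum-cong-≗ (λ i → distribʳ (w i) (u i) (v i)) ⟩
    Σᶠ.sum (λ i → (u i * w i) + (v i * w i))             ≡⟨ Σᶠ.∑-distrib-+ (λ i → u i * w i) (λ i → v i * w i) ⟩
    Σᶠ.sum (λ i → u i * w i) + Σᶠ.sum (λ i → v i * w i)  ≡⟨ cong₂ _+_ (sumF≡sum (λ i → u i * w i))
                                                                      (sumF≡sum (λ i → v i * w i)) ⟨
    u · w + v · w                                        ∎
    where open ≡-Reasoning

  ·-scaleʳ : ∀ {k} (u v : Word k) l → u · (λ i → l * v i) ≡ l * (u · v)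
  ·-scaleʳ u v l = begin
    u · (λ i → l * v i)             ≡⟨ sumF≡sum (λ i → u i * (l * v i)) ⟩
    Σᶠ.sum (λ i → u i * (l * v i))  ≡⟨ Σᶠ.sum-cong-≗ (λ i → x∙yz≈y∙xz (u i) l (v i)) ⟩
    Σᶠ.sum (λ i → l * (u i * v i))  ≡⟨ Σᶠ.*-distribˡ-sum l (λ i → u i * v i) ⟨
    l * Σᶠ.sum (λ i → u i * v i)    ≡⟨ cong (l *_) (sumF≡sum (λ i → u i * v i)) ⟨
    l * (u · v)                     ∎
    where open ≡-Reasoning

  ·-zeroˡ : ∀ {k} {u : Word k} (v : Word k) → (∀ i → u i ≡ 0#) → u · v ≡ 0#
  ·-zeroˡ {k} {u} v u≡0 = begin
    u · v                     ≡⟨ sumF≡sum (λ i → u i * v i) ⟩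
    Σᶠ.sum (λ i → u i * v i)  ≡⟨ Σᶠ.sum-cong-≗ (λ i → trans (cong (_* v i) (u≡0 i)) (zeroˡ (v i))) ⟩
    Σᶠ.sum {k} (const 0#)     ≡⟨ Σᶠ.sum-replicate-zero k ⟩
    0#                        ∎
    where open ≡-Reasoning

  Nonzero : ∀ {n} → Word n → Set
  Nonzero w = ∃ λ i → w i ≢ 0#

  zero-or-nonzero : ∀ {n} (w : Word n) → (∀ i → w i ≡ 0#) ⊎ Nonzero w
  zero-or-nonzero {n} w with Finₚ.all? (λ i → w i ≟ 0#)
  ... | yes w≡0 = inj₁ w≡0
  ... | no  w≢0 = inj₂ (Finₚ.¬∀⟶∃¬ n _ (λ i → w i ≟ 0#) w≢0)

  head≢0 : ∀ {k} (δ : Word (suc k)) → Nonzero δ → (∀ i → tail δ i ≡ 0#) → δ zero ≢ 0#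
  head≢0 δ (zero  , δ₀≢0) tail≡0 = δ₀≢0
  head≢0 δ (suc i , δᵢ≢0) tail≡0 = ⊥-elim (δᵢ≢0 (tail≡0 i))

  isNonzero : Carrier → ℕ
  isNonzero x with x ≟ 0#
  ... | yes _ = 0
  ... | no  _ = 1

  isNonzero≤1 : ∀ x → isNonzero x ≤ 1
  isNonzero≤1 x with x ≟ 0#
  ... | yes _ = z≤n
  ... | no  _ = s≤s z≤n

  isNonzero-≡0 : ∀ {x} → x ≡ 0# → isNonzero x ≡ 0
  isNonzero-≡0 {x} x≡0 with x ≟ 0#
  ... | yes _   = refl
  ... | no  x≢0 = ⊥-elim (x≢0 x≡0)

  isNonzero-≢0 : ∀ {x} → x ≢ 0# → isNonzero x ≡ 1
  isNonzero-≢0 {x} x≢0 with x ≟ 0#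
  ... | yes x≡0 = ⊥-elim (x≢0 x≡0)
  ... | no  _   = refl

  weight : ∀ {n} → Word n → ℕ
  weight w = sum (isNonzero ∘ w)

  weight-cong : ∀ {n} {w w′ : Word n} → (∀ j → w j ≡ w′ j) → weight w ≡ weight w′
  weight-cong w≗w′ = sum-cong-≗ (cong isNonzero ∘ w≗w′)

  weight-↑ : ∀ m {n} (w : Word (m ℕ.+ n)) → weight w ≡ weight (w ∘ (_↑ˡ n)) ℕ.+ weight (w ∘ (m ↑ʳ_))
  weight-↑ m w = sum-↑ m (isNonzero ∘ w)

  weight-combine : ∀ m n (w : Word (m ℕ.* n)) → weight w ≡ ∑[ i < m ] weight (λ j → w (combine i j))
  weight-combine m n w = sum-combine m n (isNonzero ∘ w)

  weight≤1+weight-tail : ∀ {n} (w : Word (suc n)) → weight w ≤ suc (weight (tail w))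
  weight≤1+weight-tail w = ℕₚ.+-monoˡ-≤ (weight (tail w)) (isNonzero≤1 (w zero))

  weight-const : ∀ n x → weight {n} (const x) ≡ n ℕ.* isNonzero x
  weight-const n x = sum-const n (isNonzero x)

  weight-zero : ∀ {n} (w : Word n) → (∀ j → w j ≡ 0#) → weight w ≡ 0
  weight-zero {n} w w≡0 = trans (sum-cong-≗ (isNonzero-≡0 ∘ w≡0)) (trans (sum-const n 0) (ℕₚ.*-zeroʳ n))

  weight-full : ∀ {n} (w : Word n) → (∀ j → w j ≢ 0#) → weight w ≡ n
  weight-full {n} w w≢0 = trans (sum-cong-≗ (isNonzero-≢0 ∘ w≢0)) (trans (sum-const n 1) (ℕₚ.*-identityʳ n))

  length≤1+weight : ∀ {n} (w : Word n) → (∀ i j → w i ≡ 0# → w j ≡ 0# → i ≡ j) → n ≤ suc (weight w)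
  length≤1+weight {zero}  w unique = z≤n
  length≤1+weight {suc n} w unique with w zero ≟ 0#
  ... | yes w₀≡0 = s≤s (ℕₚ.≤-reflexive (sym (weight-full (tail w)
                      λ j wⱼ≡0 → Finₚ.0≢1+n (unique zero (suc j) w₀≡0 wⱼ≡0))))
  ... | no  _    = s≤s (length≤1+weight (tail w)
                      λ i j wᵢ≡0 wⱼ≡0 → Finₚ.suc-injective (unique (suc i) (suc j) wᵢ≡0 wⱼ≡0))

  support : ∀ {n} → Word n → Subset n
  support {zero}  w = []
  support {suc n} w with w zero ≟ 0#
  ... | yes _ = outside Vec.∷ support (tail w)
  ... | no  _ = inside Vec.∷ support (tail w)

  ∣support∣≡weight : ∀ {n} (w : Word n) → ∣ support w ∣ ≡ weight w
  ∣support∣≡weight {zero}  w = refl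
  ∣support∣≡weight {suc n} w with w zero ≟ 0#
  ... | yes _ = ∣support∣≡weight (tail w)
  ... | no  _ = cong suc (∣support∣≡weight (tail w))

  ∈support⇒≢0 : ∀ {n} (w : Word n) {j} → j ∈ support w → w j ≢ 0#
  ∈support⇒≢0 {suc n} w j∈ with w zero ≟ 0# | j∈
  ... | yes _    | there j∈′ = ∈support⇒≢0 (tail w) j∈′
  ... | no w₀≢0 | here      = w₀≢0
  ... | no _     | there j∈′ = ∈support⇒≢0 (tail w) j∈′

  ≢0⇒∈support : ∀ {n} (w : Word n) {j} → w j ≢ 0# → j ∈ support w
  ≢0⇒∈support {suc n} w {zero} w₀≢0 with w zero ≟ 0#
  ... | yes w₀≡0 = ⊥-elim (w₀≢0 w₀≡0)
  ... | no  _    = here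
  ≢0⇒∈support {suc n} w {suc j} wⱼ≢0 with w zero ≟ 0#
  ... | yes _ = there (≢0⇒∈support (tail w) wⱼ≢0)
  ... | no  _ = there (≢0⇒∈support (tail w) wⱼ≢0)

  DistAtLeast-0⇒≤weight : ∀ {n d} (w : Word n) → DistAtLeast d w (const 0#) → d ≤ weight w
  DistAtLeast-0⇒≤weight {d = d} w (S , d≤∣S∣ , S≢0) = begin
    d                ≤⟨ d≤∣S∣ ⟩
    ∣ S ∣            ≤⟨ p⊆q⇒∣p∣≤∣q∣ (λ {j} j∈S → ≢0⇒∈support w (S≢0 j j∈S)) ⟩
    ∣ support w ∣    ≡⟨ ∣support∣≡weight w ⟩
    weight w         ∎
    where open ℕₚ.≤-Reasoning

  ≤weight⇒DistAtLeast : ∀ {n d} {c c′ : Word n} (w : Word n) →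
    (∀ j → w j ≢ 0# → c j ≢ c′ j) → d ≤ weight w → DistAtLeast d c c′
  ≤weight⇒DistAtLeast w w≢0⇒c≢c′ d≤w =
    support w , ℕₚ.≤-trans d≤w (ℕₚ.≤-reflexive (sym (∣support∣≡weight w))) ,
    λ j j∈ → w≢0⇒c≢c′ j (∈support⇒≢0 w j∈)

  Columns : ℕ → ℕ → Set
  Columns k n = Vector (Word k) n

  columns : ∀ {n k d} → LinCode n k d → Columns k n
  columns C = flip (LinCode.G C)

  codeword : ∀ {k n} → Columns k n → Word k → Word n
  codeword cols m j = m · cols j

  WeightAtLeast : ∀ {k n} → ℕ → Columns k n → Set
  WeightAtLeast d cols = ∀ m → Nonzero m → d ≤ weight (codeword cols m)

  linCode⇒WeightAtLeast : ∀ {n k d} (C : LinCode n k d) → WeightAtLeast d (columns C)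
  linCode⇒WeightAtLeast C m (i , mᵢ≢0) with zero-or-nonzero (codeword (columns C) m)
  ... | inj₁ c≡0 = ⊥-elim (mᵢ≢0 (LinCode.independent C m c≡0 i))
  ... | inj₂ c≢0 = DistAtLeast-0⇒≤weight _ (LinCode.minDist C _ (const 0#) (m , λ _ → refl) 0∈C c≢0)
    where
    0∈C : InCode (LinCode.G C) (const 0#)
    0∈C = const 0# , λ j → sym (·-zeroˡ (columns C j) λ _ → refl)

  codeword-split : ∀ {k n} (cols : Columns k n) m m′ j →
    codeword cols m j ≡ codeword cols m′ j + codeword cols (λ i → (- m′ i) + m i) j
  codeword-split cols m m′ j = trans (·-cong (λ i → sym (\\-leftDividesˡ (m′ i) (m i))) (λ _ → refl))
                                     (·-distribʳ-+ m′ (λ i → (- m′ i) + m i) (cols j))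

  linCode : ∀ {k n d} (cols : Columns k n) → 1 ≤ d → WeightAtLeast d cols → LinCode n k d
  linCode {k} {n} {d} cols 1≤d wt = record { G = flip cols ; independent = independent ; minDist = minDist }
    where
    independent : RowsIndependent (flip cols)
    independent m c≡0 i with m i ≟ 0#
    ... | yes mᵢ≡0 = mᵢ≡0
    ... | no  mᵢ≢0 = ⊥-elim (ℕₚ.1+n≰n (begin
      1                           ≤⟨ 1≤d ⟩
      d                           ≤⟨ wt m (i , mᵢ≢0) ⟩
      weight (codeword cols m)    ≡⟨ weight-zero (codeword cols m) c≡0 ⟩
      0                           ∎))
      where open ℕₚ.≤-Reasoning

    minDist : ∀ c c′ → InCode (flip cols) c → InCode (flip cols) c′ →
      Σ (Fin n) (λ j → c j ≢ c′ j) → DistAtLeast d c c′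
    minDist c c′ (m , c≡) (m′ , c′≡) (j₀ , cⱼ₀≢c′ⱼ₀) = [ equal , differ ] (zero-or-nonzero δ)
      where
      δ : Word k
      δ i = (- m′ i) + m i
      c≡c′+δ : ∀ j → c j ≡ c′ j + codeword cols δ j
      c≡c′+δ j = trans (c≡ j) (trans (codeword-split cols m m′ j) (cong (_+ codeword cols δ j) (sym (c′≡ j))))
      equal : (∀ i → δ i ≡ 0#) → DistAtLeast d c c′
      equal δ≡0 = ⊥-elim (cⱼ₀≢c′ⱼ₀ (begin
        c j₀                          ≡⟨ c≡c′+δ j₀ ⟩
        c′ j₀ + codeword cols δ j₀    ≡⟨ cong (c′ j₀ +_) (·-zeroˡ (cols j₀) δ≡0) ⟩
        c′ j₀ + 0#                    ≡⟨ +-identityʳ (c′ j₀) ⟩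
        c′ j₀                         ∎))
        where open ≡-Reasoning
      δ≢0⇒c≢c′ : ∀ j → codeword cols δ j ≢ 0# → c j ≢ c′ j
      δ≢0⇒c≢c′ j δⱼ≢0 cⱼ≡c′ⱼ = δⱼ≢0 (∙-cancelˡ (c′ j) _ _ (begin
        c′ j + codeword cols δ j      ≡⟨ c≡c′+δ j ⟨
        c j                           ≡⟨ cⱼ≡c′ⱼ ⟩
        c′ j                          ≡⟨ +-identityʳ (c′ j) ⟨
        c′ j + 0#                     ∎))
        where open ≡-Reasoning
      differ : Nonzero δ → DistAtLeast d c c′
      differ δ≢0 = ≤weight⇒DistAtLeast (codeword cols δ) δ≢0⇒c≢c′ (wt δ δ≢0)

  weight-codeword-++ : ∀ {k a b} (A : Columns k a) (B : Columns k b) m →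
    weight (codeword (A ++ B) m) ≡ weight (codeword A m) ℕ.+ weight (codeword B m)
  weight-codeword-++ {a = a} A B m = trans (weight-↑ a (codeword (A ++ B) m))
    (cong₂ ℕ._+_ (weight-cong λ i → cong (m ·_) (lookup-++ˡ A B i))
                 (weight-cong λ j → cong (m ·_) (lookup-++ʳ A B j)))

  WeightAtLeast-++ : ∀ {k a b d e} (A : Columns k a) (B : Columns k b) →
    WeightAtLeast d A → WeightAtLeast e B → WeightAtLeast (d ℕ.+ e) (A ++ B)
  WeightAtLeast-++ A B wtA wtB m m≢0 =
    ℕₚ.≤-trans (ℕₚ.+-mono-≤ (wtA m m≢0) (wtB m m≢0)) (ℕₚ.≤-reflexive (sym (weight-codeword-++ A B m)))

  WeightAtLeast-mono : ∀ {k n d e} (A : Columns k n) → d ≤ e → WeightAtLeast e A → WeightAtLeast d A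
  WeightAtLeast-mono A d≤e wt m m≢0 = ℕₚ.≤-trans d≤e (wt m m≢0)

  WeightAtLeast-tail : ∀ {k n d} (A : Columns k (suc n)) →
    WeightAtLeast d A → WeightAtLeast (d ℕ.∸ 1) (tail A)
  WeightAtLeast-tail A wt m m≢0 =
    ℕₚ.∸-monoˡ-≤ 1 (ℕₚ.≤-trans (wt m m≢0) (weight≤1+weight-tail (codeword A m)))

  infix 4 _∝_ _⊑_

  _∝_ : ∀ {k} → Word k → Word k → Set
  u ∝ v = ∃ λ l → ∀ i → u i ≡ l * v i

  _⊑_ : ∀ {k a b} → Columns k a → Columns k b → Set
  A ⊑ B = ∀ i → ∃ λ j → A i ∝ B j

  ∝-refl : ∀ {k} {u : Word k} → u ∝ u
  ∝-refl = 1# , λ i → sym (*-identityˡ _)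

  ∝-↑ˡ : ∀ {k b c} {u : Word k} (B : Columns k b) (C : Columns k c) j → u ∝ B j → u ∝ (B ++ C) (j ↑ˡ c)
  ∝-↑ˡ B C j = subst (_ ∝_) (sym (lookup-++ˡ B C j))

  ∝-↑ʳ : ∀ {k b c} {u : Word k} (B : Columns k b) (C : Columns k c) j → u ∝ C j → u ∝ (B ++ C) (b ↑ʳ j)
  ∝-↑ʳ B C j = subst (_ ∝_) (sym (lookup-++ʳ B C j))

  ⊑-refl : ∀ {k n} {A : Columns k n} → A ⊑ A
  ⊑-refl i = i , ∝-refl

  tail-⊑ : ∀ {k n} {A : Columns k (suc n)} → tail A ⊑ A
  tail-⊑ i = suc i , ∝-refl

  ⊑-++ˡ : ∀ {k a b c} {A : Columns k a} (B : Columns k b) (C : Columns k c) → A ⊑ B → A ⊑ B ++ C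
  ⊑-++ˡ {c = c} B C A⊑B = Product.map (_↑ˡ c) (λ {j} → ∝-↑ˡ B C j) ∘ A⊑B

  ⊑-++ʳ : ∀ {k a b c} {A : Columns k a} (B : Columns k b) (C : Columns k c) → A ⊑ C → A ⊑ B ++ C
  ⊑-++ʳ {b = b} B C A⊑C = Product.map (b ↑ʳ_) (λ {j} → ∝-↑ʳ B C j) ∘ A⊑C

  ++-⊑ : ∀ {k a b c} (A : Columns k a) (B : Columns k b) {C : Columns k c} → A ⊑ C → B ⊑ C → A ++ B ⊑ C
  ++-⊑ A B {C} A⊑C B⊑C = ↑-elim (λ x → ∃ λ j → (A ++ B) x ∝ C j)
    (λ i → subst (λ u → ∃ λ j → u ∝ C j) (sym (lookup-++ˡ A B i)) (A⊑C i))
    (λ i → subst (λ u → ∃ λ j → u ∝ C j) (sym (lookup-++ʳ A B i)) (B⊑C i))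

  ++-partner : ∀ {k a b} {A : Columns k a} {B : Columns k b} → A ⊑ B → B ⊑ A →
    ∀ x → ∃ λ y → x ≢ y × (A ++ B) x ∝ (A ++ B) y
  ++-partner {a = a} {b} {A} {B} A⊑B B⊑A = ↑-elim _ left right
    where
    left : ∀ i → ∃ λ y → i ↑ˡ b ≢ y × (A ++ B) (i ↑ˡ b) ∝ (A ++ B) y
    left i with A⊑B i
    ... | j , Aᵢ∝Bⱼ =
      a ↑ʳ j , ↑ˡ≢↑ʳ i j , subst₂ _∝_ (sym (lookup-++ˡ A B i)) (sym (lookup-++ʳ A B j)) Aᵢ∝Bⱼ
    right : ∀ j → ∃ λ y → a ↑ʳ j ≢ y × (A ++ B) (a ↑ʳ j) ∝ (A ++ B) y
    right j with B⊑A j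
    ... | i , Bⱼ∝Aᵢ =
      i ↑ˡ b , ↑ˡ≢↑ʳ i j ∘ sym , subst₂ _∝_ (sym (lookup-++ʳ A B j)) (sym (lookup-++ˡ A B i)) Bⱼ∝Aᵢ

  locality₁ : ∀ {n k d} (C : LinCode n k d) →
    (∀ x → ∃ λ y → x ≢ y × columns C x ∝ columns C y) → HasLocality C 1
  locality₁ C partner x with partner x
  ... | y , x≢y , l , colₓ≡ = ⁅ y ⁆ , x≢y⇒x∉⁅y⁆ x≢y , ℕₚ.≤-reflexive (∣⁅x⁆∣≡1 y) , agree
    where
    cₓ≡l*c_y : ∀ c → InCode (LinCode.G C) c → c x ≡ l * c y
    cₓ≡l*c_y c (m , c≡) = begin
      c x                            ≡⟨ c≡ x ⟩
      m · columns C x                ≡⟨ ·-cong (λ _ → refl) colₓ≡ ⟩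
      m · (λ i → l * columns C y i)  ≡⟨ ·-scaleʳ m (columns C y) l ⟩
      l * (m · columns C y)          ≡⟨ cong (l *_) (c≡ y) ⟨
      l * c y                        ∎
      where open ≡-Reasoning
    agree : ∀ c c′ → InCode (LinCode.G C) c → InCode (LinCode.G C) c′ →
      (∀ j → j ∈ ⁅ y ⁆ → c j ≡ c′ j) → c x ≡ c′ x
    agree c c′ c∈C c′∈C c≡c′ =
      trans (cₓ≡l*c_y c c∈C) (trans (cong (l *_) (c≡c′ y (x∈⁅x⁆ y))) (sym (cₓ≡l*c_y c′ c′∈C)))

  localCode : ∀ {k a b d} (A : Columns k a) (B : Columns k b) →
    1 ≤ d → WeightAtLeast d (A ++ B) → A ⊑ B → B ⊑ A → HasLocalCode (a ℕ.+ b) k d 1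
  localCode A B 1≤d wt A⊑B B⊑A = C , locality₁ C (++-partner A⊑B B⊑A)
    where C = linCode (A ++ B) 1≤d wt

  allVectors : (k : ℕ) → Columns k (q ℕ.^ k)
  allVectors zero    = λ _ ()
  allVectors (suc k) = uncurry (λ i j → to i ∷ allVectors k j) ∘ remQuot (q ℕ.^ k)

  allVectors-combine : ∀ k i j → allVectors (suc k) (combine i j) ≡ to i ∷ allVectors k j
  allVectors-combine k i j = cong (uncurry (λ i j → to i ∷ allVectors k j)) (Finₚ.remQuot-combine i j)

  allVectors-surjective : ∀ k (v : Word k) → ∃ λ j → ∀ t → allVectors k j t ≡ v t
  allVectors-surjective zero    v = zero , λ ()
  allVectors-surjective (suc k) v with strictlySurjective (v zero) | allVectors-surjective k (tail v)
  ... | i , toᵢ≡v₀ | j , allⱼ≡tail =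
    combine i j , λ t → trans (cong (_$ t) (allVectors-combine k i j)) (cons t)
    where
    cons : ∀ t → (to i ∷ allVectors k j) t ≡ v t
    cons zero    = toᵢ≡v₀
    cons (suc t) = allⱼ≡tail t

  -- The nonzero vectors whose first nonzero entry is 1: one per point of the projective space.
  simplex : (k : ℕ) → Columns k (qNumber q k)
  simplex zero    = λ ()
  simplex (suc k) = map (1# ∷_) (allVectors k) ++ map (0# ∷_) (simplex k)

  ∝-simplex : ∀ k (u : Word (suc k)) → ∃ λ j → u ∝ simplex (suc k) j
  ∝-simplex k u with u zero ≟ 0#
  ∝-simplex zero    u | yes u₀≡0 = zero , 0# , λ { zero → trans u₀≡0 (sym (zeroˡ 1#)) }
  ∝-simplex (suc k) u | yes u₀≡0 with ∝-simplex k (tail u)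
  ... | j , l , tail≡ = q ℕ.^ suc k ↑ʳ j ,
    ∝-↑ʳ (map (1# ∷_) (allVectors (suc k))) (map (0# ∷_) (simplex (suc k))) j (l , u≡)
    where
    u≡ : ∀ t → u t ≡ l * (0# ∷ simplex (suc k) j) t
    u≡ zero    = trans u₀≡0 (sym (zeroʳ l))
    u≡ (suc t) = tail≡ t
  ∝-simplex k u | no u₀≢0 with inverse (u zero) u₀≢0
  ... | u₀⁻¹ , u₀u₀⁻¹≡1 with allVectors-surjective k (λ t → u₀⁻¹ * u (suc t))
  ... | j , allⱼ≡ = j ↑ˡ qNumber q k ,
    ∝-↑ˡ (map (1# ∷_) (allVectors k)) (map (0# ∷_) (simplex k)) j (u zero , u≡)
    where
    u≡ : ∀ t → u t ≡ u zero * (1# ∷ allVectors k j) t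
    u≡ zero    = sym (*-identityʳ (u zero))
    u≡ (suc t) = sym (begin
      u zero * allVectors k j t    ≡⟨ cong (u zero *_) (allⱼ≡ t) ⟩
      u zero * (u₀⁻¹ * u (suc t))  ≡⟨ *-assoc (u zero) u₀⁻¹ (u (suc t)) ⟨
      (u zero * u₀⁻¹) * u (suc t)  ≡⟨ cong (_* u (suc t)) u₀u₀⁻¹≡1 ⟩
      1# * u (suc t)               ≡⟨ *-identityˡ (u (suc t)) ⟩
      u (suc t)                    ∎)
      where open ≡-Reasoning

  ⊑-simplex : ∀ {k n} (A : Columns (suc k) n) → A ⊑ simplex (suc k)
  ⊑-simplex {k} A i = ∝-simplex k (A i)

  weight-affine-split : ∀ k (δ : Word (suc k)) a →
    weight (λ j → a + δ · allVectors (suc k) j) ≡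
    ∑[ i < q ] weight (λ j → (a + (δ zero * to i)) + tail δ · allVectors k j)
  weight-affine-split k δ a = trans (weight-combine q (q ℕ.^ k) _) (sum-cong-≗ λ i → weight-cong λ j →
    trans (cong (λ v → a + δ · v) (allVectors-combine k i j)) (sym (+-assoc a _ _)))

  -- Stated additively because of truncated subtraction: v ↦ a + δ · v has at most q^k zeros.
  affine-weight : ∀ k (δ : Word (suc k)) a → Nonzero δ →
    q ℕ.^ suc k ≤ weight (λ j → a + δ · allVectors (suc k) j) ℕ.+ q ℕ.^ k
  affine-weight k δ a δ≢0 with zero-or-nonzero (tail δ)
  affine-weight k δ a δ≢0 | inj₁ δ′≡0 = begin
    q ℕ.* q ℕ.^ k                         ≤⟨ ℕₚ.*-monoˡ-≤ (q ℕ.^ k) (length≤1+weight root root-unique) ⟩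
    q ℕ.^ k ℕ.+ weight root ℕ.* q ℕ.^ k   ≡⟨ ℕₚ.+-comm (q ℕ.^ k) _ ⟩
    weight root ℕ.* q ℕ.^ k ℕ.+ q ℕ.^ k   ≡⟨ cong (ℕ._+ q ℕ.^ k) (ℕₚ.*-comm (weight root) _) ⟩
    q ℕ.^ k ℕ.* weight root ℕ.+ q ℕ.^ k   ≡⟨ cong (ℕ._+ q ℕ.^ k) weight≡ ⟨
    weight (λ j → a + δ · allVectors (suc k) j) ℕ.+ q ℕ.^ k ∎
    where
    open ℕₚ.≤-Reasoning
    root : Word q
    root i = a + (δ zero * to i)
    root-unique : ∀ i i′ → root i ≡ 0# → root i′ ≡ 0# → i ≡ i′
    root-unique i i′ rootᵢ≡0 rootᵢ′≡0 =
      injective (*-cancelˡ-≢0 (head≢0 δ δ≢0 δ′≡0) (∙-cancelˡ a _ _ (trans rootᵢ≡0 (sym rootᵢ′≡0))))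
    weight≡ : weight (λ j → a + δ · allVectors (suc k) j) ≡ q ℕ.^ k ℕ.* weight root
    weight≡ = begin-equality
      weight (λ j → a + δ · allVectors (suc k) j)             ≡⟨ weight-affine-split k δ a ⟩
      ∑[ i < q ] weight (λ j → root i + tail δ · allVectors k j)
        ≡⟨ sum-cong-≗ (λ i → weight-cong λ j →
             trans (cong (root i +_) (·-zeroˡ (allVectors k j) δ′≡0)) (+-identityʳ (root i))) ⟩
      ∑[ i < q ] weight {q ℕ.^ k} (const (root i))            ≡⟨ sum-cong-≗ (λ i → weight-const (q ℕ.^ k) (root i)) ⟩
      ∑[ i < q ] (q ℕ.^ k ℕ.* isNonzero (root i))             ≡⟨ *-distribˡ-sum (q ℕ.^ k) (isNonzero ∘ root) ⟨
      q ℕ.^ k ℕ.* weight root                                 ∎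
  affine-weight zero    δ a δ≢0 | inj₂ (() , _)
  affine-weight (suc k) δ a δ≢0 | inj₂ δ′≢0 = begin
    q ℕ.* q ℕ.^ suc k                        ≡⟨ sum-const q (q ℕ.^ suc k) ⟨
    ∑[ i < q ] (q ℕ.^ suc k)                 ≤⟨ sum-mono-≤ (λ i → affine-weight k (tail δ) (a + (δ zero * to i)) δ′≢0) ⟩
    ∑[ i < q ] (w i ℕ.+ q ℕ.^ k)             ≡⟨ ∑-distrib-+ w (const (q ℕ.^ k)) ⟩
    ∑[ i < q ] w i ℕ.+ ∑[ i < q ] (q ℕ.^ k)  ≡⟨ cong₂ ℕ._+_ (weight-affine-split (suc k) δ a)
                                                             (sym (sum-const q (q ℕ.^ k))) ⟨
    weight (λ j → a + δ · allVectors (suc (suc k)) j) ℕ.+ q ℕ.^ suc k ∎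
    where
    open ℕₚ.≤-Reasoning
    w : Fin q → ℕ
    w i = weight (λ j → (a + (δ zero * to i)) + tail δ · allVectors (suc k) j)

  simplex-WeightAtLeast : ∀ k → WeightAtLeast (q ℕ.^ k) (simplex (suc k))
  simplex-WeightAtLeast k δ δ≢0 with zero-or-nonzero (tail δ)
  simplex-WeightAtLeast k δ δ≢0 | inj₁ δ′≡0 = begin
    q ℕ.^ k                                                 ≡⟨ weight-full (codeword top δ) δ·top≢0 ⟨
    weight (codeword top δ)                                 ≤⟨ ℕₚ.m≤m+n _ _ ⟩
    weight (codeword top δ) ℕ.+ weight (codeword bottom δ)  ≡⟨ weight-codeword-++ top bottom δ ⟨
    weight (codeword (simplex (suc k)) δ)                   ∎
    where
    open ℕₚ.≤-Reasoning
    top = map (1# ∷_) (allVectors k)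
    bottom = map (0# ∷_) (simplex k)
    δ·top≡δ₀ : ∀ j → δ · top j ≡ δ zero
    δ·top≡δ₀ j = trans (cong ((δ zero * 1#) +_) (·-zeroˡ (allVectors k j) δ′≡0))
                       (trans (+-identityʳ (δ zero * 1#)) (*-identityʳ (δ zero)))
    δ·top≢0 : ∀ j → δ · top j ≢ 0#
    δ·top≢0 j δ·topⱼ≡0 = head≢0 δ δ≢0 δ′≡0 (trans (sym (δ·top≡δ₀ j)) δ·topⱼ≡0)
  simplex-WeightAtLeast zero    δ δ≢0 | inj₂ (() , _)
  simplex-WeightAtLeast (suc k) δ δ≢0 | inj₂ δ′≢0 = begin
    q ℕ.^ suc k                                ≤⟨ affine-weight k (tail δ) (δ zero * 1#) δ′≢0 ⟩
    weight (codeword top δ) ℕ.+ q ℕ.^ k        ≤⟨ ℕₚ.+-monoʳ-≤ (weight (codeword top δ))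
                                                                (simplex-WeightAtLeast k (tail δ) δ′≢0) ⟩
    weight (codeword top δ) ℕ.+ weight (codeword (simplex (suc k)) (tail δ))
      ≡⟨ cong (weight (codeword top δ) ℕ.+_) (weight-cong δ·bottom≡) ⟨
    weight (codeword top δ) ℕ.+ weight (codeword bottom δ)  ≡⟨ weight-codeword-++ top bottom δ ⟨
    weight (codeword (simplex (suc (suc k))) δ)             ∎
    where
    open ℕₚ.≤-Reasoning
    top = map (1# ∷_) (allVectors (suc k))
    bottom = map (0# ∷_) (simplex (suc k))
    δ·bottom≡ : ∀ j → δ · bottom j ≡ tail δ · simplex (suc k) j
    δ·bottom≡ j = trans (cong (_+ (tail δ · simplex (suc k) j)) (zeroʳ (δ zero))) (+-identityˡ _)

  doubling : ∀ {n k d} → 1 ≤ d → LinCode n k d → Σ ℕ λ m → m ≤ 2 ℕ.* n × HasLocalCode m k (2 ℕ.* d) 1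
  doubling {n} {d = d} 1≤d C = n ℕ.+ n , ℕₚ.≤-reflexive (cong (n ℕ.+_) (sym (ℕₚ.+-identityʳ n))) ,
    localCode G G (ℕₚ.≤-trans 1≤d (ℕₚ.m≤m+n d _)) wt ⊑-refl ⊑-refl
    where
    G = columns C
    wt : WeightAtLeast (2 ℕ.* d) (G ++ G)
    wt = WeightAtLeast-mono (G ++ G) (ℕₚ.≤-reflexive (cong (d ℕ.+_) (ℕₚ.+-identityʳ d)))
           (WeightAtLeast-++ G G (linCode⇒WeightAtLeast C) (linCode⇒WeightAtLeast C))

  simplex-extension : ∀ {n k d} → 1 ≤ d → LinCode n (suc k) d →
    Σ ℕ λ m → m ≤ 2 ℕ.* qNumber q (suc k) ℕ.+ n × HasLocalCode m (suc k) (d ℕ.+ 2 ℕ.* q ℕ.^ k) 1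
  simplex-extension {n} {k} {d} 1≤d C = s ℕ.+ (n ℕ.+ s) , ℕₚ.≤-reflexive (length≡ s n) ,
    localCode S (G ++ S) (ℕₚ.≤-trans 1≤d (ℕₚ.m≤m+n d _)) wt
      (⊑-++ʳ G S ⊑-refl) (++-⊑ G S (⊑-simplex G) ⊑-refl)
    where
    G = columns C
    S = simplex (suc k)
    s = qNumber q (suc k)
    length≡ : ∀ s n → s ℕ.+ (n ℕ.+ s) ≡ 2 ℕ.* s ℕ.+ n
    length≡ = solve-∀
    distance≡ : ∀ d x → d ℕ.+ 2 ℕ.* x ≡ x ℕ.+ (d ℕ.+ x)
    distance≡ = solve-∀
    wt : WeightAtLeast (d ℕ.+ 2 ℕ.* q ℕ.^ k) (S ++ (G ++ S))
    wt = WeightAtLeast-mono (S ++ (G ++ S)) (ℕₚ.≤-reflexive (distance≡ d (q ℕ.^ k)))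
           (WeightAtLeast-++ S (G ++ S) (simplex-WeightAtLeast k)
             (WeightAtLeast-++ G S (linCode⇒WeightAtLeast C) (simplex-WeightAtLeast k)))

  no-code-of-length-0 : ∀ {k d} → ¬ LinCode 0 (suc k) d
  no-code-of-length-0 C = 0≢1 (sym (LinCode.independent C (const 1#) (λ ()) zero))

  tripling : ∀ {n k d} → 1 ≤ d → LinCode n (suc k) d →
    Σ ℕ λ m → m ≤ 3 ℕ.* n ℕ.∸ 1 × HasLocalCode m (suc k) (3 ℕ.* d ℕ.∸ 1) 1
  tripling {zero}  1≤d C = ⊥-elim (no-code-of-length-0 C)
  tripling {suc n} {d = d} 1≤d C =
    suc n ℕ.+ (suc n ℕ.+ n) , ℕₚ.≤-reflexive (sym (3*n∸1≡n+[n+[n∸1]] (suc n))) ,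
    localCode G (G ++ tail G) 1≤3d∸1 wt (⊑-++ˡ G (tail G) ⊑-refl) (++-⊑ G (tail G) ⊑-refl tail-⊑)
    where
    G = columns C
    wtG = linCode⇒WeightAtLeast C
    wt : WeightAtLeast (3 ℕ.* d ℕ.∸ 1) (G ++ (G ++ tail G))
    wt = WeightAtLeast-mono (G ++ (G ++ tail G)) (ℕₚ.≤-reflexive (3*n∸1≡n+[n+[n∸1]] d))
           (WeightAtLeast-++ G (G ++ tail G) wtG
             (WeightAtLeast-++ G (tail G) wtG (WeightAtLeast-tail G wtG)))
    1≤3d∸1 : 1 ≤ 3 ℕ.* d ℕ.∸ 1
    1≤3d∸1 = ℕₚ.≤-trans 1≤d (ℕₚ.≤-trans (ℕₚ.m≤m+n d _)
                                           (ℕₚ.≤-reflexive (sym (3*n∸1≡n+[n+[n∸1]] d))))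

open import Data.Nat using (_+_; _*_; _∸_; _^_)

lemma35 : (q : ℕ) → IsPrimePower q → (F : FiniteField q) →
    (k d′ : ℕ) → 1 ≤ k → 1 ≤ d′ →
    (n : ℕ) → Codes.HasCode F n k d′ →
      (Σ ℕ λ m → m ≤ 2 * n × Codes.HasLocalCode F m k (2 * d′) 1)
    × (Σ ℕ λ m → m ≤ 2 * qNumber q k + n × Codes.HasLocalCode F m k (d′ + 2 * q ^ (k ∸ 1)) 1)
    × (Σ ℕ λ m → m ≤ 3 * n ∸ 1 × Codes.HasLocalCode F m k (3 * d′ ∸ 1) 1)
lemma35 q _ F (suc k) d′ (s≤s z≤n) 1≤d′ n C =
  doubling F 1≤d′ C , simplex-extension F 1≤d′ C , tripling F 1≤d′ C
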